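{- Let $\gamma$ be the morphism on $\{a,b,c\}^*$ given by $a\mapsto aca$, $b\mapsto cab$, $c\mapsto b$. For every integer $k\ge 1$, $\gamma^k$ does not have any conjugate in class $\mathcal P$.
   Context: A morphism $\varphi$ is in class $\mathcal P$ if there is a palindrome $p$ and, for each letter $\alpha$, a palindrome $q_\alpha$ with $\varphi(\alpha)=pq_\alpha$. Write $\varphi\triangleleft\varphi'$ if there is a word $w$ with $\varphi(x)w=w\varphi'(x)$ for all words $x$; $\varphi,\varphi'$ are conjugate if $\varphi\triangleleft\varphi'$ or $\varphi'\triangleleft\varphi$. -}

module Defs where

open import Data.List using (List; []; _∷_; _++_; reverse; concatMap; [_])
open import Data.Nat using (ℕ; zero; suc)
open import Data.Product using (Σ; _×_; ∃; _,_)
open import Data.Sum using (_⊎_)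
open import Relation.Binary.PropositionalEquality using (_≡_)

data Letter : Set where
  a b c : Letter

Word : Set
Word = List Letter

-- A morphism of {a,b,c}* is determined by the images of the letters
Morphism : Set
Morphism = Letter → Word

apply : Morphism → Word → Word
apply φ x = concatMap φ x

IsPalindrome : Word → Set
IsPalindrome w = reverse w ≡ w

InClassP : Morphism → Set
InClassP φ = Σ Word λ p → IsPalindrome p ×
               ((α : Letter) → Σ Word λ q → IsPalindrome q × (φ α ≡ p ++ q))

_◁_ : Morphism → Morphism → Set
φ ◁ φ' = Σ Word λ w → (x : Word) → apply φ x ++ w ≡ w ++ apply φ' x

Conjugate : Morphism → Morphism → Set
Conjugate φ φ' = (φ ◁ φ') ⊎ (φ' ◁ φ)

γ : Morphism
γ a = a ∷ c ∷ a ∷ []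
γ b = c ∷ a ∷ b ∷ []
γ c = b ∷ []

_^[_] : Morphism → ℕ → Morphism
(φ ^[ zero ]) α = [ α ]
(φ ^[ suc k ]) α = apply φ ((φ ^[ k ]) α)

-- For k ≥ 1, γ^k(a) begins and ends with a, γ^k(b) ends with b and begins with b or c,
-- and one of γ^k(b), γ^k(c) begins with c and ends with b. If φ(x) w = w φ'(x) with w
-- non-empty, then every non-empty φ(α) begins with the first letter of w, and if
-- φ'(x) w = w φ(x), every φ(α) ends with the last letter of w; the letters a and b rule
-- both out for φ = γ^k, so its only conjugate is γ^k itself. Likewise a non-empty
-- palindrome p in the class P decomposition would be a common prefix, so every γ^k(α)
-- would be a palindrome, which an image beginning with c and ending with b is not.
module Submission where

open import Defs
open import Data.Nat using (ℕ; _≥_; suc; s≤s)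
open import Data.Nat.GeneralisedArithmetic using (fold)
open import Data.Product using (_×_; ∃; _,_)
open import Data.Sum using (_⊎_; inj₁; inj₂)
open import Data.List using ([]; _∷_; _++_; reverse; [_]; head)
open import Data.List.Properties
  using (++-identityʳ; concatMap-++; reverse-++; unfold-reverse; reverse-involutive)
open import Data.Maybe using (just)
open import Data.Maybe.Properties using (just-injective)
open import Function using (_∘_)
open import Relation.Nullary using (¬_; contradiction)
open import Relation.Binary.PropositionalEquality hiding ([_])

head-++ : ∀ {u v : Word} {x} → head u ≡ just x → head (u ++ v) ≡ just x
head-++ {_ ∷ _} eq = eq

head-apply : ∀ (φ : Morphism) {u x y} →
             head u ≡ just x → head (φ x) ≡ just y → head (apply φ u) ≡ just y
head-apply φ {_ ∷ _} refl = head-++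

apply-letter : ∀ (φ : Morphism) α → apply φ [ α ] ≡ φ α
apply-letter φ α = ++-identityʳ (φ α)

reverse-apply : ∀ (φ : Morphism) u → reverse (apply φ u) ≡ apply (reverse ∘ φ) (reverse u)
reverse-apply φ [] = refl
reverse-apply φ (x ∷ u) = begin
  reverse (φ x ++ apply φ u)                          ≡⟨ reverse-++ (φ x) (apply φ u) ⟩
  reverse (apply φ u) ++ reverse (φ x)                ≡⟨ cong₂ _++_ (reverse-apply φ u)
                                                                    (sym (apply-letter (reverse ∘ φ) x)) ⟩
  apply ρφ (reverse u) ++ apply ρφ [ x ]              ≡⟨ concatMap-++ ρφ (reverse u) [ x ] ⟨
  apply ρφ (reverse u ++ [ x ])                       ≡⟨ cong (apply ρφ) (unfold-reverse x u) ⟨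
  apply ρφ (reverse (x ∷ u))                          ∎
  where
    open ≡-Reasoning
    ρφ : Morphism
    ρφ = reverse ∘ φ

module _ (φ : Morphism) (f : Letter → Letter) where

  head-^ : (∀ α → head (φ α) ≡ just (f α)) →
           ∀ k α → head ((φ ^[ k ]) α) ≡ just (fold α f k)
  head-^ head-φ 0       α = refl
  head-^ head-φ (suc k) α = head-apply φ (head-^ head-φ k α) (head-φ _)

  last-^ : (∀ α → head (reverse (φ α)) ≡ just (f α)) →
           ∀ k α → head (reverse ((φ ^[ k ]) α)) ≡ just (fold α f k)
  last-^ last-φ 0       α = refl
  last-^ last-φ (suc k) α rewrite reverse-apply φ ((φ ^[ k ]) α) =
    head-apply (reverse ∘ φ) (last-^ last-φ k α) (last-φ _)

module _ {A : Set} (f : A → A) where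

  fold-involutive : (∀ x → f (f x) ≡ x) →
                    ∀ k → (∀ x → fold x f k ≡ x) ⊎ (∀ x → fold x f k ≡ f x)
  fold-involutive inv 0       = inj₁ λ _ → refl
  fold-involutive inv (suc k) with fold-involutive inv k
  ... | inj₁ fixed   = inj₂ λ x → cong f (fixed x)
  ... | inj₂ flipped = inj₁ λ x → trans (cong f (flipped x)) (inv x)

  fold-idempotent : (∀ x → f (f x) ≡ f x) → ∀ k x → fold x f (suc k) ≡ f x
  fold-idempotent idem 0       x = refl
  fold-idempotent idem (suc k) x = trans (cong f (fold-idempotent idem k x)) (idem x)

distinct-heads⇒conjugator≡[] : ∀ {u u′ v v′ w : Word} {x y} →
  u ++ w ≡ w ++ u′ → v ++ w ≡ w ++ v′ →
  head u ≡ just x → head v ≡ just y → x ≢ y → w ≡ []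
distinct-heads⇒conjugator≡[] {w = []}    _  _  _      _      _   = refl
distinct-heads⇒conjugator≡[] {w = z ∷ w} eu ev head-u head-v x≢y =
  contradiction (trans (first-letter eu head-u) (sym (first-letter ev head-v))) x≢y
  where
    first-letter : ∀ {s s′ x} → s ++ z ∷ w ≡ z ∷ w ++ s′ → head s ≡ just x → x ≡ z
    first-letter eq head-s = just-injective (trans (sym (head-++ head-s)) (cong head eq))

conjugator-at-letter : ∀ {φ φ′ : Morphism} {w} →
  (∀ x → apply φ x ++ w ≡ w ++ apply φ′ x) → ∀ α → φ α ++ w ≡ w ++ φ′ α
conjugator-at-letter {φ} {φ′} {w} conj α = begin
  φ α ++ w              ≡⟨ cong (_++ w) (apply-letter φ α) ⟨
  apply φ [ α ] ++ w    ≡⟨ conj [ α ] ⟩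
  w ++ apply φ′ [ α ]   ≡⟨ cong (w ++_) (apply-letter φ′ α) ⟩
  w ++ φ′ α             ∎
  where open ≡-Reasoning

reverse-conjugator : ∀ {u u′ w : Word} →
  u ++ w ≡ w ++ u′ → reverse u′ ++ reverse w ≡ reverse w ++ reverse u
reverse-conjugator {u} {u′} {w} eq = begin
  reverse u′ ++ reverse w   ≡⟨ reverse-++ w u′ ⟨
  reverse (w ++ u′)         ≡⟨ cong reverse eq ⟨
  reverse (u ++ w)          ≡⟨ reverse-++ u w ⟩
  reverse w ++ reverse u    ∎
  where open ≡-Reasoning

module _ {φ φ′ : Morphism} {α β : Letter} where

  ◁-distinct-heads⇒≗ : ∀ {x y} → φ ◁ φ′ →
    head (φ α) ≡ just x → head (φ β) ≡ just y → x ≢ y → φ′ ≗ φ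
  ◁-distinct-heads⇒≗ (w , conj) head-α head-β x≢y δ
    with distinct-heads⇒conjugator≡[] (at α) (at β) head-α head-β x≢y
    where
      at : ∀ ε → φ ε ++ w ≡ w ++ φ′ ε
      at = conjugator-at-letter conj
  ... | refl = sym (trans (sym (++-identityʳ (φ δ))) (conjugator-at-letter conj δ))

  ▷-distinct-lasts⇒≗ : ∀ {x y} → φ′ ◁ φ →
    head (reverse (φ α)) ≡ just x → head (reverse (φ β)) ≡ just y → x ≢ y → φ′ ≗ φ
  ▷-distinct-lasts⇒≗ (w , conj) last-α last-β x≢y δ
    with trans (sym (reverse-involutive w))
               (cong reverse (distinct-heads⇒conjugator≡[] (at α) (at β) last-α last-β x≢y))
    where
      at : ∀ ε → reverse (φ ε) ++ reverse w ≡ reverse w ++ reverse (φ′ ε)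
      at ε = reverse-conjugator {φ′ ε} {φ ε} {w} (conjugator-at-letter conj ε)
  ... | refl = trans (sym (++-identityʳ (φ′ δ))) (conjugator-at-letter conj δ)

  conjugate⇒≗ : ∀ {x y x′ y′} → Conjugate φ φ′ →
    head (φ α) ≡ just x → head (φ β) ≡ just y → x ≢ y →
    head (reverse (φ α)) ≡ just x′ → head (reverse (φ β)) ≡ just y′ → x′ ≢ y′ →
    φ′ ≗ φ
  conjugate⇒≗ (inj₁ φ◁φ′) head-α head-β x≢y _ _ _ = ◁-distinct-heads⇒≗ φ◁φ′ head-α head-β x≢y
  conjugate⇒≗ (inj₂ φ′◁φ) _ _ _ last-α last-β x′≢y′ = ▷-distinct-lasts⇒≗ φ′◁φ last-α last-β x′≢y′

InClassP-resp-≗ : ∀ {φ ψ : Morphism} → φ ≗ ψ → InClassP φ → InClassP ψ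
InClassP-resp-≗ φ≗ψ (p , pal-p , split) = p , pal-p , λ α →
  let (q , pal-q , eq) = split α in q , pal-q , trans (sym (φ≗ψ α)) eq

InClassP-distinct-heads⇒palindromic : ∀ {φ : Morphism} {α β x y} → InClassP φ →
  head (φ α) ≡ just x → head (φ β) ≡ just y → x ≢ y → ∀ δ → IsPalindrome (φ δ)
InClassP-distinct-heads⇒palindromic ([] , _ , split) _ _ _ δ =
  let (q , pal-q , eq) = split δ in subst IsPalindrome (sym eq) pal-q
InClassP-distinct-heads⇒palindromic {φ} {α} {β} (z ∷ p , _ , split) head-α head-β x≢y _ =
  contradiction (trans (first-letter α head-α) (sym (first-letter β head-β))) x≢y
  where
    first-letter : ∀ ε {x} → head (φ ε) ≡ just x → x ≡ z
    first-letter ε head-ε =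
      let (_ , _ , eq) = split ε in just-injective (trans (sym head-ε) (cong head eq))

palindrome-ends : ∀ {w : Word} {x y} →
  IsPalindrome w → head w ≡ just x → head (reverse w) ≡ just y → x ≡ y
palindrome-ends pal head-w last-w =
  just-injective (trans (sym head-w) (trans (cong head (sym pal)) last-w))

initial final : Letter → Letter
initial a = a
initial b = c
initial c = b
final a = a
final b = b
final c = b

head-γ : ∀ α → head (γ α) ≡ just (initial α)
head-γ a = refl
head-γ b = refl
head-γ c = refl

last-γ : ∀ α → head (reverse (γ α)) ≡ just (final α)
last-γ a = refl
last-γ b = refl
last-γ c = refl

initial-involutive : ∀ α → initial (initial α) ≡ α
initial-involutive a = refl
initial-involutive b = refl
initial-involutive c = refl

final-idempotent : ∀ α → final (final α) ≡ final α
final-idempotent a = refl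
final-idempotent b = refl
final-idempotent c = refl

module _ (m : ℕ) where

  head-γ^ : ∀ α → head ((γ ^[ suc m ]) α) ≡ just (fold α initial (suc m))
  head-γ^ = head-^ γ initial head-γ (suc m)

  last-γ^ : ∀ α → head (reverse ((γ ^[ suc m ]) α)) ≡ just (final α)
  last-γ^ α = trans (last-^ γ final last-γ (suc m) α)
                    (cong just (fold-idempotent final final-idempotent m α))

  initial^-a≢b : fold a initial (suc m) ≢ fold b initial (suc m)
  initial^-a≢b with fold-involutive initial initial-involutive (suc m)
  ... | inj₁ fixed   rewrite fixed a   | fixed b   = λ ()
  ... | inj₂ flipped rewrite flipped a | flipped b = λ ()

  conjugate-γ^⇒≗ : ∀ {φ′} → Conjugate (γ ^[ suc m ]) φ′ → φ′ ≗ γ ^[ suc m ]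
  conjugate-γ^⇒≗ conj =
    conjugate⇒≗ conj (head-γ^ a) (head-γ^ b) initial^-a≢b (last-γ^ a) (last-γ^ b) λ ()

  γ^-from-c-to-b : ∃ λ δ → head ((γ ^[ suc m ]) δ) ≡ just c
                         × head (reverse ((γ ^[ suc m ]) δ)) ≡ just b
  γ^-from-c-to-b with fold-involutive initial initial-involutive (suc m)
  ... | inj₁ fixed   = c , trans (head-γ^ c) (cong just (fixed c))   , last-γ^ c
  ... | inj₂ flipped = b , trans (head-γ^ b) (cong just (flipped b)) , last-γ^ b

  γ^∉P : ¬ InClassP (γ ^[ suc m ])
  γ^∉P γ^∈P =
    let (δ , starts-c , ends-b) = γ^-from-c-to-b
        palindromic = InClassP-distinct-heads⇒palindromic γ^∈P (head-γ^ a) (head-γ^ b) initial^-a≢b δ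
    in c≢b (palindrome-ends palindromic starts-c ends-b)
    where
      c≢b : c ≢ b
      c≢b ()

mainTheorem8 : (k : ℕ) → k ≥ 1 → (φ' : Morphism) →
    ¬ (Conjugate (γ ^[ k ]) φ' × InClassP φ')
mainTheorem8 (suc m) (s≤s _) φ' (conj , φ'∈P) =
  γ^∉P m (InClassP-resp-≗ (conjugate-γ^⇒≗ m conj) φ'∈P)
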